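{- Let $G$ be a connected $P_5$-free graph that admits a proper perfect edge dominating set $P$, with associated 3-colouring $(B,Y,W)$. Then $G$ has a dominating set $\{v_1,v_2,v_3\}$ inducing a path $v_1v_2v_3$ (edges $v_1v_2$, $v_2v_3$, and $v_1v_3\notin E(G)$) whose colours $(c(v_1),c(v_2),c(v_3))$ are one of: (a) $(B,B,Y)$ or $(Y,B,B)$; (b) $(B,Y,W)$ or $(W,Y,B)$; (c) $(Y,B,Y)$; (d) $(W,Y,W)$; (e) $(Y,W,Y)$.
   Context: Graphs are finite, simple and undirected; a graph is $P_5$-free if it has no induced path on 5 vertices. An edge dominates itself and every edge sharing an endpoint with it. A set $P\subseteq E(G)$ is a perfect edge dominating set if every edge of $E(G)\setminus P$ is dominated by exactly one edge of $P$, and an efficient edge dominating set if every edge of $E(G)$ is dominated by exactly one edge of $P$; $E(G)$ is the trivial one; $P$ is proper if it is neither trivial nor efficient. The 3-colouring $(B,Y,W)$ associated to $P$: $B$ = vertices incident to at least two edges of $P$, $Y$ = vertices incident to exactly one edge of $P$, $W$ = vertices incident to no edge of $P$; $c(v)$ denotes the class containing $v$. A set $X$ of vertices is dominating if every vertex outside $X$ has a neighbour in $X$. -}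

module Defs where

open import Data.Nat using (ℕ)
open import Data.Fin using (Fin)
open import Data.Bool using (Bool; true; false)
open import Data.Product using (Σ; ∃; ∃-syntax; _×_; _,_)
open import Data.Sum using (_⊎_)
open import Data.Empty using (⊥)
open import Relation.Nullary using (¬_)
open import Relation.Binary.PropositionalEquality using (_≡_; _≢_)

record Graph (n : ℕ) : Set where
  field
    adj   : Fin n → Fin n → Bool
    sym   : ∀ u v → adj u v ≡ adj v u
    irrefl : ∀ v → adj v v ≡ false

module _ {n : ℕ} (G : Graph n) where
  open Graph G

  Adj : Fin n → Fin n → Set
  Adj u v = adj u v ≡ true

  data Walk : Fin n → Fin n → Set where
    [] : ∀ {v} → Walk v v
    step : ∀ {u v w} → Adj u v → Walk v w → Walk u w

  Connected : Set
  Connected = ∀ u v → Walk u v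

  InducedP5 : Fin n → Fin n → Fin n → Fin n → Fin n → Set
  InducedP5 a b c d e =
    (a ≢ b × a ≢ c × a ≢ d × a ≢ e × b ≢ c × b ≢ d × b ≢ e × c ≢ d × c ≢ e × d ≢ e)
    × (Adj a b × Adj b c × Adj c d × Adj d e)
    × (¬ Adj a c × ¬ Adj a d × ¬ Adj a e × ¬ Adj b d × ¬ Adj b e × ¬ Adj c e)

  P5Free : Set
  P5Free = ∀ a b c d e → ¬ InducedP5 a b c d e

  record EdgeSet : Set where
    field
      mem    : Fin n → Fin n → Bool
      memSym : ∀ u v → mem u v ≡ mem v u
      ⊆E     : ∀ u v → mem u v ≡ true → Adj u v

  SameEdge : Fin n → Fin n → Fin n → Fin n → Set
  SameEdge a b c d = (a ≡ c × b ≡ d) ⊎ (a ≡ d × b ≡ c)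

  Dominates : Fin n → Fin n → Fin n → Fin n → Set
  Dominates a b c d = a ≡ c ⊎ a ≡ d ⊎ b ≡ c ⊎ b ≡ d

  module _ (P : EdgeSet) where
    open EdgeSet P

    InP : Fin n → Fin n → Set
    InP u v = mem u v ≡ true

    DominatedExactlyOnce : Fin n → Fin n → Set
    DominatedExactlyOnce c d =
      (∃[ a ] ∃[ b ] (InP a b × Dominates a b c d))
      × (∀ a b a' b' → InP a b → Dominates a b c d →
                       InP a' b' → Dominates a' b' c d → SameEdge a b a' b')

    PerfectEDS : Set
    PerfectEDS = ∀ c d → Adj c d → ¬ InP c d → DominatedExactlyOnce c d

    EfficientEDS : Set
    EfficientEDS = ∀ c d → Adj c d → DominatedExactlyOnce c d

    Trivial : Set
    Trivial = ∀ u v → Adj u v → InP u v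

    Proper : Set
    Proper = ¬ Trivial × ¬ EfficientEDS

    InB : Fin n → Set
    InB v = ∃[ w ] ∃[ w' ] (w ≢ w' × InP v w × InP v w')

    InY : Fin n → Set
    InY v = ∃[ w ] (InP v w × (∀ w' → InP v w' → w' ≡ w))

    InW : Fin n → Set
    InW v = ∀ w → ¬ InP v w

  Dominating3 : Fin n → Fin n → Fin n → Set
  Dominating3 v₁ v₂ v₃ = ∀ x → x ≡ v₁ ⊎ x ≡ v₂ ⊎ x ≡ v₃ ⊎ Adj x v₁ ⊎ Adj x v₂ ⊎ Adj x v₃

  InducedP3 : Fin n → Fin n → Fin n → Set
  InducedP3 v₁ v₂ v₃ = Adj v₁ v₂ × Adj v₂ v₃ × v₁ ≢ v₃ × ¬ Adj v₁ v₃

module _ {n : ℕ} {G : Graph n} (P : EdgeSet G) where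
  AllowedColours : Fin n → Fin n → Fin n → Set
  AllowedColours v₁ v₂ v₃ =
      (InB G P v₁ × InB G P v₂ × InY G P v₃)
    ⊎ (InY G P v₁ × InB G P v₂ × InB G P v₃)
    ⊎ (InB G P v₁ × InY G P v₂ × InW G P v₃)
    ⊎ (InW G P v₁ × InY G P v₂ × InB G P v₃)
    ⊎ (InY G P v₁ × InB G P v₂ × InY G P v₃)
    ⊎ (InW G P v₁ × InY G P v₂ × InW G P v₃)
    ⊎ (InY G P v₁ × InW G P v₂ × InY G P v₃)

-- Both B and W are nonempty: without B-vertices P is a matching, hence efficient, and
-- without W-vertices the P-edges at the two ends of an edge outside P would both dominate
-- it, so P is trivial.  No edge joins B to W or W to W, and the only non-white neighbour
-- of a Y-vertex is its P-partner; so a walk from B to W passes through a Y-vertex adjacent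
-- to both colours.  Take such a y whose set of W-neighbours is ⊂-maximal, its partner
-- b ∈ B, and a W-neighbour w of y whose set of Y-neighbours is ⊂-maximal.  Then b y w is
-- an induced path coloured (B,Y,W), and a vertex at distance two from {b, y, w} would
-- close an induced P₅: directly, or through a vertex supplied by one of the maximalities.
module Submission where

open import Defs
open import Data.Nat using (ℕ)
open import Data.Bool using (true)
open import Data.Bool.Properties using (_≟_)
open import Data.Fin using (Fin)
open import Data.Fin.Properties using (any?) renaming (_≟_ to _≟ᶠ_)
open import Data.Fin.Subset using (Subset; _∈_; _⊃_)
open import Data.Fin.Subset.Properties using (_⊂?_)
open import Data.Fin.Subset.Induction using (⊃-wellFounded)
open import Data.Vec using (tabulate)
open import Data.Vec.Properties using (lookup∘tabulate; lookup⇒[]=; []=⇒lookup)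
open import Data.Product using (∃-syntax; _×_; _,_; proj₁; proj₂)
open import Data.Sum using (_⊎_; inj₁; inj₂; [_,_]′)
open import Data.Empty using (⊥; ⊥-elim)
open import Function using (_∘_; _on_)
open import Induction.WellFounded using (Acc; acc)
import Relation.Binary.Construct.On as On
open import Relation.Nullary using (¬_; Dec; yes; no; does)
open import Relation.Nullary.Decidable using (dec-true; _×-dec_; ¬?)
open import Relation.Unary using (Pred; Decidable; Satisfiable)
open import Relation.Binary.PropositionalEquality using (_≡_; _≢_; refl; sym; trans; subst)

⊂-Maximal : ∀ {n k c ℓ} → Pred (Fin n) c → (Fin n → Pred (Fin k) ℓ) → Pred (Fin n) _
⊂-Maximal C N m = C m × (∀ {v z} → C v → N v z → ¬ N m z → ∃[ u ] N m u × ¬ N v u)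

module _ {n k c ℓ} {C : Pred (Fin n) c} {N : Fin n → Pred (Fin k) ℓ} (N? : ∀ v → Decidable (N v)) where

  private
    ⟦_⟧ : Fin n → Subset k
    ⟦ v ⟧ = tabulate (does ∘ N? v)

    ∈⟦⟧⁺ : ∀ {v x} → N v x → x ∈ ⟦ v ⟧
    ∈⟦⟧⁺ {v} {x} p = lookup⇒[]= x ⟦ v ⟧ (trans (lookup∘tabulate _ x) (dec-true (N? v x) p))

    ∈⟦⟧⁻ : ∀ {v x} → x ∈ ⟦ v ⟧ → N v x
    ∈⟦⟧⁻ {v} {x} x∈ with N? v x | trans (sym (lookup∘tabulate (does ∘ N? v) x)) ([]=⇒lookup x∈)
    ... | yes p | _ = p
    ... | no _ | ()

  ∃-⊂-maximal : Decidable C → Satisfiable C → Satisfiable (⊂-Maximal C N)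
  ∃-⊂-maximal C? (v , cv) = climb (On.wellFounded ⟦_⟧ ⊃-wellFounded v) cv
    where
    climb : ∀ {m} → Acc (_⊃_ on ⟦_⟧) m → C m → Satisfiable (⊂-Maximal C N)
    climb {m} (acc larger) cm with any? (λ v → C? v ×-dec (⟦ m ⟧ ⊂? ⟦ v ⟧))
    ... | yes (v , cv , m⊂v) = climb (larger m⊂v) cv
    ... | no none-larger = m , cm , escape
      where
      escape : ∀ {v z} → C v → N v z → ¬ N m z → ∃[ u ] N m u × ¬ N v u
      escape {v} {z} cv nvz ¬nmz with any? (λ u → N? m u ×-dec ¬? (N? v u))
      ... | yes found = found
      ... | no none =
        ⊥-elim (none-larger (v , cv , (λ {x} → ∈⟦⟧⁺ ∘ included x ∘ ∈⟦⟧⁻) , z , ∈⟦⟧⁺ nvz , ¬nmz ∘ ∈⟦⟧⁻))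
        where
        included : ∀ x → N m x → N v x
        included x nmx with N? v x
        ... | yes nvx = nvx
        ... | no ¬nvx = ⊥-elim (none (x , nmx , ¬nvx))

  ⊂-maximal-nonempty : ∀ {m v z} → ⊂-Maximal C N m → C v → N v z → Satisfiable (N m)
  ⊂-maximal-nonempty {m} {z = z} (_ , maximal) cv nvz with N? m z
  ... | yes nmz = z , nmz
  ... | no ¬nmz with maximal cv nvz ¬nmz
  ...   | (u , nmu , _) = u , nmu

module _ {n} (G : Graph n) where

  infix 4 _~_
  _~_ : Fin n → Fin n → Set
  _~_ = Adj G

  ~-sym : ∀ {u v} → u ~ v → v ~ u
  ~-sym {u} {v} = trans (Graph.sym G v u)

  ~-irrefl : ∀ {u v} → u ~ v → u ≢ v
  ~-irrefl {u} u~u refl with trans (sym u~u) (Graph.irrefl G u)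
  ... | ()

  _~?_ : ∀ u v → Dec (u ~ v)
  u ~? v = Graph.adj G u v ≟ true

  walk-preserves : ∀ {r} {R : Pred (Fin n) r} → (∀ {u v} → R u → u ~ v → R v) →
    ∀ {u v} → Walk G u v → R u → R v
  walk-preserves step-R []              ru = ru
  walk-preserves step-R (step u~v walk) ru = walk-preserves step-R walk (step-R ru u~v)

  induced-P5 : ∀ {a b c d e} → a ~ b → b ~ c → c ~ d → d ~ e →
    ¬ a ~ c → ¬ a ~ d → ¬ a ~ e → ¬ b ~ d → ¬ b ~ e → ¬ c ~ e → InducedP5 G a b c d e
  induced-P5 ab bc cd de ¬ac ¬ad ¬ae ¬bd ¬be ¬ce =
    ( ( ~-irrefl ab , separated cd ¬ad , separated de ¬ae , separated (~-sym de) ¬ad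
      , ~-irrefl bc , separated de ¬be , separated (~-sym de) ¬bd
      , ~-irrefl cd , (λ { refl → ¬be bc }) , ~-irrefl de )
    , (ab , bc , cd , de)
    , (¬ac , ¬ad , ¬ae , ¬bd , ¬be , ¬ce) )
    where
    separated : ∀ {x y z} → y ~ z → ¬ x ~ z → x ≢ y
    separated y~z ¬x~z refl = ¬x~z y~z

  module _ (P : EdgeSet G) where

    infix 4 _—_
    _—_ : Fin n → Fin n → Set
    _—_ = InP G P

    B Y W : Pred (Fin n) _
    B = InB G P
    Y = InY G P
    W = InW G P

    —-sym : ∀ {u v} → u — v → v — u
    —-sym {u} {v} = trans (EdgeSet.memSym P v u)

    _—?_ : ∀ u v → Dec (u — v)
    u —? v = EdgeSet.mem P u v ≟ true

    colour : ∀ v → B v ⊎ Y v ⊎ W v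
    colour v with any? (v —?_)
    ... | no no-partner = inj₂ (inj₂ (λ w p → no-partner (w , p)))
    ... | yes (w , p) with any? (λ w′ → ¬? (w′ ≟ᶠ w) ×-dec v —? w′)
    ...   | yes (w′ , w′≢w , p′) = inj₁ (w , w′ , w′≢w ∘ sym , p , p′)
    ...   | no no-other = inj₂ (inj₁ (w , p , unique))
      where
      unique : ∀ w′ → v — w′ → w′ ≡ w
      unique w′ p′ with w′ ≟ᶠ w
      ... | yes w′≡w = w′≡w
      ... | no w′≢w = ⊥-elim (no-other (w′ , w′≢w , p′))

    B∩Y=∅ : ∀ {v} → B v → ¬ Y v
    B∩Y=∅ (w , w′ , w≢w′ , p , p′) (u , _ , only-u) = w≢w′ (trans (only-u w p) (sym (only-u w′ p′)))

    B∩W=∅ : ∀ {v} → B v → ¬ W v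
    B∩W=∅ (w , _ , _ , p , _) white = white w p

    Y∩W=∅ : ∀ {v} → Y v → ¬ W v
    Y∩W=∅ (u , p , _) white = white u p

    B? : Decidable B
    B? v with colour v
    ... | inj₁ b        = yes b
    ... | inj₂ (inj₁ y) = no λ b → B∩Y=∅ b y
    ... | inj₂ (inj₂ w) = no λ b → B∩W=∅ b w

    Y? : Decidable Y
    Y? v with colour v
    ... | inj₁ b        = no (B∩Y=∅ b)
    ... | inj₂ (inj₁ y) = yes y
    ... | inj₂ (inj₂ w) = no λ y → Y∩W=∅ y w

    W? : Decidable W
    W? v with colour v
    ... | inj₁ b        = no (B∩W=∅ b)
    ... | inj₂ (inj₁ y) = no (Y∩W=∅ y)
    ... | inj₂ (inj₂ w) = yes w

    ¬W⇒partner : ∀ {v} → ¬ W v → ∃[ u ] v — u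
    ¬W⇒partner {v} ¬white with any? (v —?_)
    ... | yes partner = partner
    ... | no no-partner = ⊥-elim (¬white (λ u p → no-partner (u , p)))

    SameEdge-euclidean : ∀ {a b a′ b′ c d} → SameEdge G a b c d → SameEdge G a′ b′ c d → SameEdge G a b a′ b′
    SameEdge-euclidean (inj₁ (refl , refl)) (inj₁ (refl , refl)) = inj₁ (refl , refl)
    SameEdge-euclidean (inj₁ (refl , refl)) (inj₂ (refl , refl)) = inj₂ (refl , refl)
    SameEdge-euclidean (inj₂ (refl , refl)) (inj₁ (refl , refl)) = inj₂ (refl , refl)
    SameEdge-euclidean (inj₂ (refl , refl)) (inj₂ (refl , refl)) = inj₁ (refl , refl)

    module Perfect (perfect : PerfectEDS G P) where

      W-independent : ∀ {u v} → W u → W v → ¬ u ~ v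
      W-independent {u} {v} white-u white-v u~v with perfect u v u~v (white-u v)
      ... | (a , b , p , inj₁ refl) , _                   = white-u b p
      ... | (a , b , p , inj₂ (inj₁ refl)) , _            = white-v b p
      ... | (a , b , p , inj₂ (inj₂ (inj₁ refl))) , _     = white-u a (—-sym p)
      ... | (a , b , p , inj₂ (inj₂ (inj₂ refl))) , _     = white-v a (—-sym p)

      B≁W : ∀ {u v} → B u → W v → ¬ u ~ v
      B≁W {u} (w , w′ , w≢w′ , p , p′) white-v u~v
        with proj₂ (perfect u _ u~v (white-v u ∘ —-sym)) u w u w′ p (inj₁ refl) p′ (inj₁ refl)
      ... | inj₁ (_ , w≡w′) = w≢w′ w≡w′
      ... | inj₂ (u≡w′ , _) = ~-irrefl (EdgeSet.⊆E P u w′ p′) u≡w′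

      Y-nonwhite-neighbour-is-partner : ∀ {v u} (yellow : Y v) → v ~ u → ¬ W u → u ≡ proj₁ yellow
      Y-nonwhite-neighbour-is-partner {v} {u} (p , v—p , only-p) v~u ¬white-u with v —? u
      ... | yes v—u = only-p u v—u
      ... | no ¬v—u with ¬W⇒partner ¬white-u
      ...   | (q , u—q) with proj₂ (perfect v u v~u ¬v—u) v p u q v—p (inj₁ refl) u—q (inj₂ (inj₁ refl))
      ...     | inj₁ (v≡u , _) = ⊥-elim (~-irrefl v~u v≡u)
      ...     | inj₂ (_ , p≡u) = sym p≡u

      Y-nonwhite-neighbour-unique : ∀ {v u u′} → Y v → v ~ u → v ~ u′ → ¬ W u → ¬ W u′ → u ≡ u′
      Y-nonwhite-neighbour-unique yellow v~u v~u′ ¬white-u ¬white-u′ =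
        trans (Y-nonwhite-neighbour-is-partner yellow v~u ¬white-u)
              (sym (Y-nonwhite-neighbour-is-partner yellow v~u′ ¬white-u′))

      ¬efficient⇒∃B : ¬ EfficientEDS G P → Satisfiable B
      ¬efficient⇒∃B ¬efficient with any? B?
      ... | yes found = found
      ... | no no-B = ⊥-elim (¬efficient efficient)
        where
        matching : ∀ {v x x′} → v — x → v — x′ → x ≡ x′
        matching {v} {x} {x′} p p′ with x ≟ᶠ x′
        ... | yes x≡x′ = x≡x′
        ... | no x≢x′ = ⊥-elim (no-B (v , x , x′ , x≢x′ , p , p′))

        dominating-same : ∀ {a b c d} → c — d → a — b → Dominates G a b c d → SameEdge G a b c d
        dominating-same c—d a—b (inj₁ refl)                 = inj₁ (refl , matching a—b c—d)
        dominating-same c—d a—b (inj₂ (inj₁ refl))          = inj₂ (refl , matching a—b (—-sym c—d))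
        dominating-same c—d a—b (inj₂ (inj₂ (inj₁ refl)))   = inj₂ (matching (—-sym a—b) c—d , refl)
        dominating-same c—d a—b (inj₂ (inj₂ (inj₂ refl)))   = inj₁ (matching (—-sym a—b) (—-sym c—d) , refl)

        efficient : EfficientEDS G P
        efficient c d c~d with c —? d
        ... | no ¬c—d = perfect c d c~d ¬c—d
        ... | yes c—d = (c , d , c—d , inj₁ refl) , λ a b a′ b′ a—b dom a′—b′ dom′ →
                SameEdge-euclidean (dominating-same c—d a—b dom) (dominating-same c—d a′—b′ dom′)

      ¬trivial⇒∃W : ¬ Trivial G P → Satisfiable W
      ¬trivial⇒∃W ¬trivial with any? W?
      ... | yes found = found
      ... | no no-W = ⊥-elim (¬trivial trivial)
        where
        trivial : Trivial G P
        trivial u v u~v with u —? v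
        ... | yes u—v = u—v
        ... | no ¬u—v with ¬W⇒partner (no-W ∘ (u ,_)) | ¬W⇒partner (no-W ∘ (v ,_))
        ...   | (p , u—p) | (q , v—q)
          with proj₂ (perfect u v u~v ¬u—v) u p v q u—p (inj₁ refl) v—q (inj₂ (inj₁ refl))
        ...     | inj₁ (u≡v , _) = ⊥-elim (~-irrefl u~v u≡v)
        ...     | inj₂ (_ , p≡v) = ⊥-elim (¬u—v (subst (u —_) p≡v u—p))

      YB : Pred (Fin n) _
      YB v = Y v × ∃[ b ] B b × v ~ b

      W-nbr Y-nbr : Fin n → Pred (Fin n) _
      W-nbr v u = v ~ u × W u
      Y-nbr v u = v ~ u × Y u

      YB? : Decidable YB
      YB? v = Y? v ×-dec any? (λ b → B? b ×-dec v ~? b)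

      W-nbr? : ∀ v → Decidable (W-nbr v)
      W-nbr? v u = v ~? u ×-dec W? u

      Y-nbr? : ∀ v → Decidable (Y-nbr v)
      Y-nbr? v u = v ~? u ×-dec Y? u

      ∃YB-with-W-nbr : Connected G → Satisfiable B → Satisfiable W → ∃[ v ] YB v × Satisfiable (W-nbr v)
      ∃YB-with-W-nbr connected (b , black-b) (w , white-w) with any? (λ v → YB? v ×-dec any? (W-nbr? v))
      ... | yes found = found
      ... | no none = ⊥-elim (¬reached (walk-preserves extend (connected b w) (inj₁ black-b)))
        where
        extend : ∀ {u v} → B u ⊎ YB u → u ~ v → B v ⊎ YB v
        extend {u} {v} (inj₁ black-u) u~v with colour v
        ... | inj₁ black-v        = inj₁ black-v
        ... | inj₂ (inj₁ yellow-v) = inj₂ (yellow-v , u , black-u , ~-sym u~v)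
        ... | inj₂ (inj₂ white-v)  = ⊥-elim (B≁W black-u white-v u~v)
        extend {u} {v} (inj₂ (yellow-u , b , black-b , u~b)) u~v with colour v
        ... | inj₁ black-v        = inj₁ black-v
        ... | inj₂ (inj₁ yellow-v) = ⊥-elim (B∩Y=∅ (subst B (Y-nonwhite-neighbour-unique yellow-u u~b u~v
                                       (B∩W=∅ black-b) (Y∩W=∅ yellow-v)) black-b) yellow-v)
        ... | inj₂ (inj₂ white-v)  = ⊥-elim (none (u , (yellow-u , b , black-b , u~b) , v , u~v , white-v))

        ¬reached : ¬ (B w ⊎ YB w)
        ¬reached (inj₁ black-w)       = B∩W=∅ black-w white-w
        ¬reached (inj₂ (yellow-w , _)) = Y∩W=∅ yellow-w white-w

      module Domination (p5-free : P5Free G) {b y w : Fin n}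
        (black-b : B b) (yellow-y : Y y) (white-w : W w) (y~b : y ~ b) (y~w : y ~ w)
        (y-maximal : ⊂-Maximal YB W-nbr y) (w-maximal : ⊂-Maximal (W-nbr y) Y-nbr w)
        where

        no-P5 : ∀ {a₁ a₂ a₃ a₄ a₅} → a₁ ~ a₂ → a₂ ~ a₃ → a₃ ~ a₄ → a₄ ~ a₅ →
          ¬ a₁ ~ a₃ → ¬ a₁ ~ a₄ → ¬ a₁ ~ a₅ → ¬ a₂ ~ a₄ → ¬ a₂ ~ a₅ → ¬ a₃ ~ a₅ → ⊥
        no-P5 a₁₂ a₂₃ a₃₄ a₄₅ ¬a₁₃ ¬a₁₄ ¬a₁₅ ¬a₂₄ ¬a₂₅ ¬a₃₅ =
          p5-free _ _ _ _ _ (induced-P5 a₁₂ a₂₃ a₃₄ a₄₅ ¬a₁₃ ¬a₁₄ ¬a₁₅ ¬a₂₄ ¬a₂₅ ¬a₃₅)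

        ¬b~w : ¬ b ~ w
        ¬b~w = B≁W black-b white-w

        y-nonwhite-neighbour-is-b : ∀ {u} → y ~ u → ¬ W u → u ≡ b
        y-nonwhite-neighbour-is-b y~u ¬white-u =
          Y-nonwhite-neighbour-unique yellow-y y~u y~b ¬white-u (B∩W=∅ black-b)

        induced-path : InducedP3 G b y w
        induced-path = ~-sym y~b , y~w , (λ { refl → B∩W=∅ black-b white-w }) , ¬b~w

        Far : Pred (Fin n) _
        Far z = ¬ z ~ b × ¬ z ~ y × ¬ z ~ w

        far≢b : ∀ {z} → Far z → z ≢ b
        far≢b (_ , ¬z~y , _) refl = ¬z~y (~-sym y~b)

        y≁Y : ∀ {t} → Y t → ¬ y ~ t
        y≁Y yellow-t y~t =
          B∩Y=∅ (subst B (sym (y-nonwhite-neighbour-is-b y~t (Y∩W=∅ yellow-t))) black-b) yellow-t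

        b-nbr≁y : ∀ {x} → x ~ b → ¬ x ~ y
        b-nbr≁y x~b x~y =
          ~-irrefl x~b (y-nonwhite-neighbour-is-b (~-sym x~y) (λ white-x → B≁W black-b white-x (~-sym x~b)))

        far-not-via-b : ∀ {x z} → Far z → x ~ z → ¬ x ~ b
        far-not-via-b {x} {z} (¬z~b , ¬z~y , ¬z~w) x~z x~b with x ~? w
        ... | no ¬x~w = no-P5 (~-sym x~z) x~b (~-sym y~b) y~w ¬z~b ¬z~y ¬z~w (b-nbr≁y x~b) ¬x~w ¬b~w
        ... | yes x~w with colour x | W? z
        ...   | inj₁ black-x | _ = B≁W black-x white-w x~w
        ...   | inj₂ (inj₂ white-x) | _ = W-independent white-x white-w x~w
        ...   | inj₂ (inj₁ yellow-x) | no ¬white-z =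
          far≢b (¬z~b , ¬z~y , ¬z~w) (Y-nonwhite-neighbour-unique yellow-x x~z x~b ¬white-z (B∩W=∅ black-b))
        ...   | inj₂ (inj₁ yellow-x) | yes white-z
          with proj₂ y-maximal (yellow-x , b , black-b , x~b) (x~z , white-z) (¬z~y ∘ ~-sym ∘ proj₁)
        ...     | (w′ , (y~w′ , white-w′) , ¬W-nbr-xw′) =
          no-P5 (~-sym x~z) x~b (~-sym y~b) y~w′ ¬z~b ¬z~y (W-independent white-z white-w′)
                (b-nbr≁y x~b) (λ x~w′ → ¬W-nbr-xw′ (x~w′ , white-w′)) (B≁W black-b white-w′)

        far-not-via-w : ∀ {x z} → Far z → x ~ z → ¬ x ~ b → ¬ x ~ w
        far-not-via-w {x} (¬z~b , ¬z~y , ¬z~w) x~z ¬x~b x~w =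
          no-P5 (~-sym x~z) x~w (~-sym y~w) y~b ¬z~w ¬z~y ¬z~b ¬x~y ¬x~b (¬b~w ∘ ~-sym)
          where
          ¬x~y : ¬ x ~ y
          ¬x~y x~y = ¬b~w (subst (_~ w) x≡b x~w)
            where
            x≡b : x ≡ b
            x≡b = y-nonwhite-neighbour-is-b (~-sym x~y) (λ white-x → W-independent white-x white-w x~w)

        far-not-via-y : ∀ {x z} → Far z → x ~ z → ¬ x ~ b → ¬ x ~ w → ¬ x ~ y
        far-not-via-y {x} {z} far@(¬z~b , ¬z~y , ¬z~w) x~z ¬x~b ¬x~w x~y with W? x
        ... | no ¬white-x = ¬z~b (subst (z ~_) (y-nonwhite-neighbour-is-b (~-sym x~y) ¬white-x) (~-sym x~z))
        ... | yes white-x with colour z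
        ...   | inj₁ black-z = B≁W black-z white-x (~-sym x~z)
        ...   | inj₂ (inj₂ white-z) = W-independent white-z white-x (~-sym x~z)
        ...   | inj₂ (inj₁ yellow-z)
          with proj₂ w-maximal (~-sym x~y , white-x) (x~z , yellow-z) (¬z~w ∘ ~-sym ∘ proj₁)
        ...     | (t , (w~t , yellow-t) , ¬Y-nbr-xt) with t ~? z
        ...       | no ¬t~z =
          no-P5 (~-sym x~z) x~y y~w w~t ¬z~y ¬z~w (¬t~z ∘ ~-sym) ¬x~w (¬Y-nbr-xt ∘ (_, yellow-t)) (y≁Y yellow-t)
        ...       | yes t~z =
          no-P5 t~z (~-sym x~z) x~y y~b (¬Y-nbr-xt ∘ (_, yellow-t) ∘ ~-sym) (y≁Y yellow-t ∘ ~-sym) ¬t~b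
                ¬z~y ¬z~b ¬x~b
          where
          ¬t~b : ¬ t ~ b
          ¬t~b t~b = far≢b far (Y-nonwhite-neighbour-unique yellow-t t~z t~b (Y∩W=∅ yellow-z) (B∩W=∅ black-b))

        far-not-second-neighbour : ∀ {x z} → Far z → x ~ z → ¬ (x ~ b ⊎ x ~ y ⊎ x ~ w)
        far-not-second-neighbour {x} far x~z = [ ¬x~b , [ far-not-via-y far x~z ¬x~b ¬x~w , ¬x~w ]′ ]′
          where
          ¬x~b : ¬ x ~ b
          ¬x~b = far-not-via-b far x~z
          ¬x~w : ¬ x ~ w
          ¬x~w = far-not-via-w far x~z ¬x~b

        dominated-step : ∀ {x z} → (x ≡ b ⊎ x ≡ y ⊎ x ≡ w ⊎ x ~ b ⊎ x ~ y ⊎ x ~ w) → x ~ z →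
          z ≡ b ⊎ z ≡ y ⊎ z ≡ w ⊎ z ~ b ⊎ z ~ y ⊎ z ~ w
        dominated-step (inj₁ refl)               x~z = inj₂ (inj₂ (inj₂ (inj₁ (~-sym x~z))))
        dominated-step (inj₂ (inj₁ refl))        x~z = inj₂ (inj₂ (inj₂ (inj₂ (inj₁ (~-sym x~z)))))
        dominated-step (inj₂ (inj₂ (inj₁ refl))) x~z = inj₂ (inj₂ (inj₂ (inj₂ (inj₂ (~-sym x~z)))))
        dominated-step {z = z} (inj₂ (inj₂ (inj₂ x~byw))) x~z with z ~? b | z ~? y | z ~? w
        ... | yes z~b | _       | _       = inj₂ (inj₂ (inj₂ (inj₁ z~b)))
        ... | no _    | yes z~y | _       = inj₂ (inj₂ (inj₂ (inj₂ (inj₁ z~y))))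
        ... | no _    | no _    | yes z~w = inj₂ (inj₂ (inj₂ (inj₂ (inj₂ z~w))))
        ... | no ¬z~b | no ¬z~y | no ¬z~w = ⊥-elim (far-not-second-neighbour (¬z~b , ¬z~y , ¬z~w) x~z x~byw)

        dominating : Connected G → Dominating3 G b y w
        dominating connected x = walk-preserves dominated-step (connected b x) (inj₁ refl)

theorem23 : ∀ {n : ℕ} (G : Graph n) → Connected G → P5Free G →
    (P : EdgeSet G) → PerfectEDS G P → Proper G P →
    ∃[ v₁ ] ∃[ v₂ ] ∃[ v₃ ]
    (InducedP3 G v₁ v₂ v₃ × Dominating3 G v₁ v₂ v₃ × AllowedColours P v₁ v₂ v₃)
theorem23 G connected p5-free P perfect (¬trivial , ¬efficient) =
  let (v₀ , YB-v₀ , _ , W-nbr-v₀) = ∃YB-with-W-nbr connected (¬efficient⇒∃B ¬efficient) (¬trivial⇒∃W ¬trivial)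
      (y , y-maximal@((yellow-y , b , black-b , y~b) , _)) = ∃-⊂-maximal W-nbr? YB? (v₀ , YB-v₀)
      (w , w-maximal@((y~w , white-w) , _)) =
        ∃-⊂-maximal Y-nbr? (W-nbr? y) (⊂-maximal-nonempty W-nbr? y-maximal YB-v₀ W-nbr-v₀)
      open Domination p5-free black-b yellow-y white-w y~b y~w y-maximal w-maximal
  in b , y , w , induced-path , dominating connected , inj₂ (inj₂ (inj₁ (black-b , yellow-y , white-w)))
  where open Perfect G P perfect
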